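{- Let $k\le n$ be positive integers, $q$ a prime power and $\mathbb{F}_q$ the field with $q$ elements. Then $|Y^{\mathbb{F}_q}_{n,k}| = [k]!_q\cdot\mathrm{Stir}_q(n,k)$.
   Context: $\mathcal{M}_{n,k}^{\mathbb{F}_q}$ is the set of full-rank $k\times n$ matrices over $\mathbb{F}_q$ with no zero column; $U\subseteq GL_k(\mathbb{F}_q)$ is the group of lower triangular matrices with $1$'s on the diagonal; $T\subseteq GL_n(\mathbb{F}_q)$ is the group of invertible diagonal matrices. $Y^{\mathbb{F}_q}_{n,k}=U\backslash\mathcal{M}^{\mathbb{F}_q}_{n,k}/T=\{UmT: m\in\mathcal{M}^{\mathbb{F}_q}_{n,k}\}$. $[m]_q=1+q+\cdots+q^{m-1}$, $[k]!_q=[1]_q\cdots[k]_q$, $\mathrm{Stir}_q(0,k)=\delta_{k,0}$, $\mathrm{Stir}_q(n,k)=\mathrm{Stir}_q(n-1,k-1)+[k]_q\mathrm{Stir}_q(n-1,k)$ for $n>0$. -}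

module Defs where

open import Data.Nat as ℕ using (ℕ; zero; suc; _<_)
open import Data.Fin using (Fin; toℕ)
open import Data.Product using (∃; _×_)
open import Relation.Binary.PropositionalEquality using (_≡_; _≢_)
open import Relation.Nullary using (¬_)
open import Algebra.Structures using (IsCommutativeRing)

[_]q : ℕ → ℕ → ℕ
[ zero  ]q q = 0
[ suc m ]q q = 1 ℕ.+ q ℕ.* [ m ]q q

[_]!q : ℕ → ℕ → ℕ
[ zero  ]!q q = 1
[ suc k ]!q q = [ k ]!q q ℕ.* [ suc k ]q q

Stirq : ℕ → ℕ → ℕ → ℕ
Stirq q zero    zero    = 1
Stirq q zero    (suc k) = 0
Stirq q (suc n) zero    = [ 0 ]q q ℕ.* Stirq q n 0
Stirq q (suc n) (suc k) = Stirq q n k ℕ.+ [ suc k ]q q ℕ.* Stirq q n (suc k)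

-- A field with exactly q elements, realised with carrier Fin q.
-- (Every finite field with q elements is isomorphic to such a structure.)

record FiniteField (q : ℕ) : Set where
  field
    _+_ _*_  : Fin q → Fin q → Fin q
    -_       : Fin q → Fin q
    0# 1#    : Fin q
    isCommutativeRing : IsCommutativeRing _≡_ _+_ _*_ -_ 0# 1#
    0≢1      : 0# ≢ 1#
    inverse  : ∀ x → x ≢ 0# → ∃ λ y → x * y ≡ 1#

module _ {q : ℕ} (F : FiniteField q) where
  open FiniteField F

  Mat : ℕ → ℕ → Set
  Mat r c = Fin r → Fin c → Fin q

  sumF : ∀ {m} → (Fin m → Fin q) → Fin q
  sumF {zero}  f = 0#
  sumF {suc m} f = f Fin.zero + sumF (λ i → f (Fin.suc i))

  _·_ : ∀ {r s c} → Mat r s → Mat s c → Mat r c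
  (A · B) i j = sumF (λ l → A i l * B l j)

  FullRank : ∀ {k n} → Mat k n → Set
  FullRank {k} {n} m =
    (c : Fin k → Fin q) → (∀ j → sumF (λ i → c i * m i j) ≡ 0#) → ∀ i → c i ≡ 0#

  NoZeroColumn : ∀ {k n} → Mat k n → Set
  NoZeroColumn {k} {n} m = ∀ j → ¬ (∀ i → m i j ≡ 0#)

  InM : (n k : ℕ) → Mat k n → Set
  InM n k m = FullRank m × NoZeroColumn m

  InU : ∀ {k} → Mat k k → Set
  InU u = (∀ i j → toℕ i < toℕ j → u i j ≡ 0#) × (∀ i → u i i ≡ 1#)

  InT : ∀ {n} → Mat n n → Set
  InT t = (∀ i j → i ≢ j → t i j ≡ 0#) × (∀ i → t i i ≢ 0#)

  SameDoubleCoset : (n k : ℕ) → Mat k n → Mat k n → Set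
  SameDoubleCoset n k m m' =
    ∃ λ (u : Mat k k) → ∃ λ (t : Mat n n) →
      InU u × InT t × (∀ i j → m' i j ≡ ((u · m) · t) i j)

-- "The set {a | P a} modulo the equivalence _~_ has exactly N classes":
-- a system of N pairwise inequivalent representatives covering every class.

record HasClassCount {A : Set} (P : A → Set) (_~_ : A → A → Set) (N : ℕ) : Set where
  field
    rep      : Fin N → A
    rep-in   : ∀ i → P (rep i)
    distinct : ∀ i j → rep i ~ rep j → i ≡ j
    cover    : ∀ a → P a → ∃ λ i → rep i ~ a

CardY : ∀ {q} → FiniteField q → (n k N : ℕ) → Set
CardY F n k N = HasClassCount (InM F n k) (SameDoubleCoset F n k) N

-- Every double coset U m T contains exactly one canonical matrix: an echelon form in
-- which each row's last nonzero entry is a pivot below which its column vanishes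
-- (reached by Gaussian elimination with the lower unitriangular U), and each column's
-- last nonzero entry is 1 (reached by the diagonal T).  Uniqueness holds because a
-- unitriangular matrix relating two echelon forms acts on them as the identity, and a
-- diagonal one must then fix the monic columns.
-- A canonical matrix is counted by its first column, an arbitrary monic vector
-- ([k]_q choices).  Either that column is the pivot of a row p, whose other entries
-- then vanish, and deleting column 0 and row p leaves a canonical (k-1) × (n-1)
-- matrix; or it is no pivot and deleting it leaves a canonical k × (n-1) matrix.
-- Hence N(n,k) = [k]_q (N(n-1,k-1) + N(n-1,k)), the recursion of [k]!_q Stir_q(n,k).

module Submission where

open import Defs
open import Data.Nat using (ℕ; _≤_; _*_)

open import Algebra.Bundles using (CommutativeRing)
open import Data.Empty using (⊥-elim)
open import Data.Fin as Fin using (Fin; zero; suc)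
open import Data.Fin.Properties using (_≟_; all?; any?; <-cmp; suc-injective; ¬Fin0; +↔⊎; *↔×)
open import Data.Nat as ℕ using (zero; suc; _+_; z<s; s<s)
open import Data.Nat.Properties using (*-zeroʳ)
open import Data.Nat.Solver using (module +-*-Solver)
open import Data.Product using (∃; ∃₂; _×_; _,_; proj₁; proj₂)
open import Data.Sum using (_⊎_; inj₁; inj₂; [_,_])
open import Data.Unit using (⊤; tt)
open import Data.Vec.Functional using (_∷_; tail; insertAt; removeAt)
open import Data.Vec.Functional.Properties using (insertAt-lookup; insertAt-punchIn; insertAt-removeAt)
open import Function using (_∘_; _↔_; Inverse)
open import Relation.Binary.Definitions using (Symmetric; Transitive; tri<; tri≈; tri>)
open import Relation.Binary.PropositionalEquality
  using (_≡_; _≢_; _≗_; refl; sym; trans; cong; cong₂; subst; module ≡-Reasoning)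
open import Relation.Nullary using (¬_; Dec; yes; no)

-- Counting equivalence classes

module _ {A : Set} {P : A → Set} {_≈_ : A → A → Set} where

  classCount-↔ : ∀ {I : Set} {N} → Fin N ↔ I → (r : I → A) → (∀ i → P (r i)) →
                 (∀ i j → r i ≈ r j → i ≡ j) → (∀ a → P a → ∃ λ i → r i ≈ a) →
                 HasClassCount P _≈_ N
  classCount-↔ Fin↔I r r-in r-distinct r-cover = record
    { rep      = r ∘ to
    ; rep-in   = r-in ∘ to
    ; distinct = λ k l e → begin
        k             ≡⟨ strictlyInverseʳ k ⟨
        from (to k)   ≡⟨ cong from (r-distinct (to k) (to l) e) ⟩
        from (to l)   ≡⟨ strictlyInverseʳ l ⟩
        l             ∎
    ; cover    = λ a Pa → let i , ri≈a = r-cover a Pa in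
        from i , subst (λ j → r j ≈ a) (sym (strictlyInverseˡ i)) ri≈a
    }
    where
    open Inverse Fin↔I using (to; from; strictlyInverseˡ; strictlyInverseʳ)
    open ≡-Reasoning

  classCount-empty : (∀ a → ¬ P a) → HasClassCount P _≈_ 0
  classCount-empty ¬P = record
    { rep = λ () ; rep-in = λ () ; distinct = λ () ; cover = λ a Pa → ⊥-elim (¬P a Pa) }

  classCount-single : (a₀ : A) → P a₀ → (∀ a → P a → a₀ ≈ a) → HasClassCount P _≈_ 1
  classCount-single a₀ Pa₀ a₀≈ = record
    { rep = λ _ → a₀ ; rep-in = λ _ → Pa₀ ; distinct = λ { zero zero _ → refl }
    ; cover = λ a Pa → zero , a₀≈ a Pa }

  classCount-⊎ : ∀ {P₁ P₂ : A → Set} {n₁ n₂} → Symmetric _≈_ →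
                 (∀ {a} → P a → P₁ a ⊎ P₂ a) → (∀ {a} → P₁ a → P a) → (∀ {a} → P₂ a → P a) →
                 (∀ {a b} → P₁ a → P₂ b → ¬ a ≈ b) →
                 HasClassCount P₁ _≈_ n₁ → HasClassCount P₂ _≈_ n₂ → HasClassCount P _≈_ (n₁ + n₂)
  classCount-⊎ {P₁} {P₂} ≈-sym split P₁⊆P P₂⊆P disjoint C₁ C₂ =
    classCount-↔ +↔⊎ r r-in r-distinct r-cover
    where
    module C₁ = HasClassCount C₁
    module C₂ = HasClassCount C₂
    r = [ C₁.rep , C₂.rep ]
    r-in : ∀ i → P (r i)
    r-in (inj₁ i) = P₁⊆P (C₁.rep-in i)
    r-in (inj₂ i) = P₂⊆P (C₂.rep-in i)
    r-distinct : ∀ i j → r i ≈ r j → i ≡ j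
    r-distinct (inj₁ i) (inj₁ j) e = cong inj₁ (C₁.distinct i j e)
    r-distinct (inj₁ i) (inj₂ j) e = ⊥-elim (disjoint (C₁.rep-in i) (C₂.rep-in j) e)
    r-distinct (inj₂ i) (inj₁ j) e = ⊥-elim (disjoint (C₁.rep-in j) (C₂.rep-in i) (≈-sym e))
    r-distinct (inj₂ i) (inj₂ j) e = cong inj₂ (C₂.distinct i j e)
    r-cover : ∀ a → P a → ∃ λ i → r i ≈ a
    r-cover a Pa with split Pa
    ... | inj₁ P₁a = let i , e = C₁.cover a P₁a in inj₁ i , e
    ... | inj₂ P₂a = let i , e = C₂.cover a P₂a in inj₂ i , e

classCount-× : ∀ {X Y A : Set} {PX : X → Set} {PY : Y → Set} {P : A → Set}
               {_≈X_ : X → X → Set} {_≈Y_ : Y → Y → Set} {_≈_ : A → A → Set} {nx ny}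
               (g : X → Y → A) → Transitive _≈_ →
               (∀ {x x′ y y′} → x ≈X x′ → y ≈Y y′ → g x y ≈ g x′ y′) →
               (∀ {x y} → PX x → PY y → P (g x y)) →
               (∀ {x y x′ y′} → PX x → PY y → PX x′ → PY y′ → g x y ≈ g x′ y′ → x ≈X x′ × y ≈Y y′) →
               (∀ a → P a → ∃₂ λ x y → PX x × PY y × g x y ≈ a) →
               HasClassCount PX _≈X_ nx → HasClassCount PY _≈Y_ ny → HasClassCount P _≈_ (nx * ny)
classCount-× {P = P} {_≈_ = _≈_} g ≈-trans g-cong g-in g-injective g-cover CX CY =
  classCount-↔ *↔× r (λ (i , j) → g-in (CX.rep-in i) (CY.rep-in j)) r-distinct r-cover
  where
  module CX = HasClassCount CX
  module CY = HasClassCount CY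
  r = λ (i , j) → g (CX.rep i) (CY.rep j)
  r-distinct : ∀ ij kl → r ij ≈ r kl → ij ≡ kl
  r-distinct (i , j) (k , l) e =
    let x≈ , y≈ = g-injective (CX.rep-in i) (CY.rep-in j) (CX.rep-in k) (CY.rep-in l) e
    in cong₂ _,_ (CX.distinct i k x≈) (CY.distinct j l y≈)
  r-cover : ∀ a → P a → ∃ λ ij → r ij ≈ a
  r-cover a Pa =
    let x , y , PXx , PYy , gxy≈a = g-cover a Pa
        i , ri≈x = CX.cover x PXx
        j , rj≈y = CY.cover y PYy
    in (i , j) , ≈-trans (g-cong ri≈x rj≈y) gxy≈a

classCount-transversal : ∀ {A : Set} {P Q : A → Set} {_≈_ _~_ : A → A → Set} {N} →
                         (∀ {a} → Q a → P a) → (∀ {a b} → Q a → Q b → a ~ b → a ≈ b) →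
                         (∀ a → P a → ∃ λ b → Q b × b ~ a) → (∀ {a a′ b} → a ≈ a′ → a′ ~ b → a ~ b) →
                         HasClassCount Q _≈_ N → HasClassCount P _~_ N
classCount-transversal Q⊆P ~⇒≈ reach ~-respˡ C = record
  { rep      = rep
  ; rep-in   = Q⊆P ∘ rep-in
  ; distinct = λ i j e → distinct i j (~⇒≈ (rep-in i) (rep-in j) e)
  ; cover    = λ a Pa → let b , Qb , b~a = reach a Pa ; i , rep≈b = cover b Qb in i , ~-respˡ rep≈b b~a
  }
  where open HasClassCount C

insertAt-cong : ∀ {A : Set} {m} {w w′ : Fin m → A} p x → w ≗ w′ → insertAt w p x ≗ insertAt w′ p x
insertAt-cong             zero    x w≗w′ zero    = refl
insertAt-cong             zero    x w≗w′ (suc r) = w≗w′ r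
insertAt-cong {m = suc m} (suc p) x w≗w′ zero    = w≗w′ zero
insertAt-cong {m = suc m} (suc p) x w≗w′ (suc r) = insertAt-cong p x (w≗w′ ∘ suc) r

module _ {q : ℕ} (F : FiniteField q) where

  open FiniteField F using (0#; 1#; 0≢1; inverse; isCommutativeRing)
    renaming (_+_ to infixl 6 _⊕_; _*_ to infixl 7 _⊗_; -_ to infix 8 ⊖_)

  ring : CommutativeRing _ _
  ring = record { isCommutativeRing = isCommutativeRing }

  open CommutativeRing ring using
    (*-assoc; *-comm; distribˡ; +-identityˡ; +-identityʳ; *-identityˡ; *-identityʳ;
     zeroˡ; zeroʳ; -‿inverseˡ; semiring; +-group)
  open import Algebra.Properties.Ring (CommutativeRing.ring ring) using (-‿distribˡ-*)
  open import Algebra.Properties.Group +-group using (\\-leftDividesʳ)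
  open import Algebra.Properties.Semiring.Sum semiring using (sum; *-distribʳ-sum; ∑-distrib-+)

  K : Set
  K = Fin q

  x≢0⇒x⊗y≡0⇒y≡0 : ∀ {x y} → x ≢ 0# → x ⊗ y ≡ 0# → y ≡ 0#
  x≢0⇒x⊗y≡0⇒y≡0 {x} {y} x≢0 xy≡0 = begin
    y               ≡⟨ *-identityˡ y ⟨
    1# ⊗ y          ≡⟨ cong (_⊗ y) (trans (sym xx⁻¹≡1) (*-comm x x⁻¹)) ⟩
    x⁻¹ ⊗ x ⊗ y     ≡⟨ *-assoc x⁻¹ x y ⟩
    x⁻¹ ⊗ (x ⊗ y)   ≡⟨ cong (x⁻¹ ⊗_) xy≡0 ⟩
    x⁻¹ ⊗ 0#        ≡⟨ zeroʳ x⁻¹ ⟩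
    0#              ∎
    where
    open ≡-Reasoning
    x⁻¹ = proj₁ (inverse x x≢0)
    xx⁻¹≡1 = proj₂ (inverse x x≢0)

  y≢0⇒x⊗y≡0⇒x≡0 : ∀ {x y} → y ≢ 0# → x ⊗ y ≡ 0# → x ≡ 0#
  y≢0⇒x⊗y≡0⇒x≡0 {x} {y} y≢0 xy≡0 = x≢0⇒x⊗y≡0⇒y≡0 y≢0 (trans (*-comm y x) xy≡0)

  ⊗-nonzero : ∀ {x y} → x ≢ 0# → y ≢ 0# → x ⊗ y ≢ 0#
  ⊗-nonzero x≢0 y≢0 = y≢0 ∘ x≢0⇒x⊗y≡0⇒y≡0 x≢0

  x⊗y≡1⇒y≢0 : ∀ {x y} → x ⊗ y ≡ 1# → y ≢ 0#
  x⊗y≡1⇒y≢0 {x} xy≡1 refl = 0≢1 (trans (sym (zeroʳ x)) xy≡1)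

  x≡0⇒x⊗y≡0 : ∀ {x} y → x ≡ 0# → x ⊗ y ≡ 0#
  x≡0⇒x⊗y≡0 y refl = zeroˡ y

  y≡0⇒x⊗y≡0 : ∀ x {y} → y ≡ 0# → x ⊗ y ≡ 0#
  y≡0⇒x⊗y≡0 x refl = zeroʳ x

  ⊖x⊗z⊕[x⊗z⊕w]≡w : ∀ x z w → (⊖ x) ⊗ z ⊕ (x ⊗ z ⊕ w) ≡ w
  ⊖x⊗z⊕[x⊗z⊕w]≡w x z w =
    trans (cong (_⊕ (x ⊗ z ⊕ w)) (sym (-‿distribˡ-* x z))) (\\-leftDividesʳ (x ⊗ z) w)

  ∑ : ∀ {m} → (Fin m → K) → K
  ∑ = sumF F

  ∑≡sum : ∀ {m} (f : Fin m → K) → ∑ f ≡ sum f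
  ∑≡sum {zero}  f = refl
  ∑≡sum {suc m} f = cong (f zero ⊕_) (∑≡sum (tail f))

  ∑-cong : ∀ {m} {f g : Fin m → K} → f ≗ g → ∑ f ≡ ∑ g
  ∑-cong {zero}  f≗g = refl
  ∑-cong {suc m} f≗g = cong₂ _⊕_ (f≗g zero) (∑-cong (f≗g ∘ suc))

  ∑-zero : ∀ {m} (f : Fin m → K) → (∀ i → f i ≡ 0#) → ∑ f ≡ 0#
  ∑-zero {zero}  f f≡0 = refl
  ∑-zero {suc m} f f≡0 = trans (cong₂ _⊕_ (f≡0 zero) (∑-zero (tail f) (f≡0 ∘ suc))) (+-identityˡ 0#)

  ∑-head : ∀ {m} (f : Fin (suc m) → K) → (∀ i → f (suc i) ≡ 0#) → ∑ f ≡ f zero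
  ∑-head f tail≡0 = trans (cong (f zero ⊕_) (∑-zero (tail f) tail≡0)) (+-identityʳ (f zero))

  ∑-single : ∀ {m} (f : Fin m → K) j → (∀ i → i ≢ j → f i ≡ 0#) → ∑ f ≡ f j
  ∑-single f zero    f≡0 = ∑-head f (λ i → f≡0 (suc i) λ ())
  ∑-single f (suc j) f≡0 = begin
    f zero ⊕ ∑ (tail f) ≡⟨ cong (_⊕ ∑ (tail f)) (f≡0 zero λ ()) ⟩
    0# ⊕ ∑ (tail f)     ≡⟨ +-identityˡ _ ⟩
    ∑ (tail f)          ≡⟨ ∑-single (tail f) j (λ i i≢j → f≡0 (suc i) (i≢j ∘ suc-injective)) ⟩
    f (suc j)           ∎
    where open ≡-Reasoning

  ∑-distribʳ : ∀ {m} (f : Fin m → K) c → ∑ (λ l → f l ⊗ c) ≡ ∑ f ⊗ c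
  ∑-distribʳ f c = begin
    ∑ (λ l → f l ⊗ c)   ≡⟨ ∑≡sum (λ l → f l ⊗ c) ⟩
    sum (λ l → f l ⊗ c) ≡⟨ *-distribʳ-sum c f ⟨
    sum f ⊗ c           ≡⟨ cong (_⊗ c) (∑≡sum f) ⟨
    ∑ f ⊗ c             ∎
    where open ≡-Reasoning

  ∑-distrib-⊕ : ∀ {m} (f g : Fin m → K) → ∑ (λ l → f l ⊕ g l) ≡ ∑ f ⊕ ∑ g
  ∑-distrib-⊕ f g = begin
    ∑ (λ l → f l ⊕ g l)   ≡⟨ ∑≡sum (λ l → f l ⊕ g l) ⟩
    sum (λ l → f l ⊕ g l) ≡⟨ ∑-distrib-+ f g ⟩
    sum f ⊕ sum g         ≡⟨ cong₂ _⊕_ (∑≡sum f) (∑≡sum g) ⟨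
    ∑ f ⊕ ∑ g             ∎
    where open ≡-Reasoning

  -- Last nonzero entries and monic vectors

  IsZero : ∀ {m} → (Fin m → K) → Set
  IsZero v = ∀ i → v i ≡ 0#

  isZero? : ∀ {m} (v : Fin m → K) → Dec (IsZero v)
  isZero? v = all? (λ i → v i ≟ 0#)

  VanishesAfter : ∀ {m} → (Fin m → K) → Fin m → Set
  VanishesAfter v p = ∀ j → p Fin.< j → v j ≡ 0#

  vanishesAfter-suc : ∀ {m} {v : Fin (suc m) → K} {p} → VanishesAfter (tail v) p → VanishesAfter v (suc p)
  vanishesAfter-suc after (suc j) (s<s p<j) = after j p<j

  vanishesAfter-suc⁻¹ : ∀ {m} {v : Fin (suc m) → K} {p} → VanishesAfter v (suc p) → VanishesAfter (tail v) p
  vanishesAfter-suc⁻¹ after j p<j = after (suc j) (s<s p<j)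

  vanishesAfter-zero : ∀ {m} {v : Fin (suc m) → K} → VanishesAfter v zero → IsZero (tail v)
  vanishesAfter-zero after j = after (suc j) z<s

  vanishesAfter-zero⁻¹ : ∀ {m} {v : Fin (suc m) → K} → IsZero (tail v) → VanishesAfter v zero
  vanishesAfter-zero⁻¹ tail≡0 (suc j) _ = tail≡0 j

  IsLastNonzero : ∀ {m} → (Fin m → K) → Fin m → Set
  IsLastNonzero v p = v p ≢ 0# × VanishesAfter v p

  isLastNonzero-unique : ∀ {m} {v : Fin m → K} {p p′} → IsLastNonzero v p → IsLastNonzero v p′ → p ≡ p′
  isLastNonzero-unique {p = p} {p′} (vp≢0 , after) (vp′≢0 , after′) with <-cmp p p′
  ... | tri< p<p′ _ _ = ⊥-elim (vp′≢0 (after p′ p<p′))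
  ... | tri≈ _ p≡p′ _ = p≡p′
  ... | tri> _ _ p′<p = ⊥-elim (vp≢0 (after′ p p′<p))

  isLastNonzero-scale : ∀ {m} {v w s : Fin m → K} {p} → (∀ j → s j ≢ 0#) → (∀ j → w j ≡ v j ⊗ s j) →
                        IsLastNonzero v p → IsLastNonzero w p
  isLastNonzero-scale {p = p} s≢0 w≡vs (vp≢0 , after) =
    (λ wp≡0 → ⊗-nonzero vp≢0 (s≢0 p) (trans (sym (w≡vs p)) wp≡0)) ,
    (λ j p<j → trans (w≡vs j) (x≡0⇒x⊗y≡0 _ (after j p<j)))

  lastNonzero : ∀ {m} (v : Fin m → K) → ¬ IsZero v → ∃ (IsLastNonzero v)
  lastNonzero {zero}  v v≢0 = ⊥-elim (v≢0 λ ())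
  lastNonzero {suc m} v v≢0 with isZero? (tail v)
  ... | yes tail≡0 =
    zero , (λ v0≡0 → v≢0 λ { zero → v0≡0 ; (suc i) → tail≡0 i }) , vanishesAfter-zero⁻¹ tail≡0
  ... | no  tail≢0 =
    let p , vp≢0 , after = lastNonzero (tail v) tail≢0 in suc p , vp≢0 , vanishesAfter-suc after

  MonicAt : ∀ {m} → (Fin m → K) → Fin m → Set
  MonicAt v p = v p ≡ 1# × VanishesAfter v p

  Monic : ∀ {m} → (Fin m → K) → Set
  Monic v = ∃ (MonicAt v)

  monicAt⇒isLastNonzero : ∀ {m} {v : Fin m → K} {p} → MonicAt v p → IsLastNonzero v p
  monicAt⇒isLastNonzero (vp≡1 , after) = (λ vp≡0 → 0≢1 (trans (sym vp≡0) vp≡1)) , after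

  monicAt-unique : ∀ {m} {v w : Fin m → K} {p p′} → v ≗ w → MonicAt v p → MonicAt w p′ → p ≡ p′
  monicAt-unique v≗w (vp≡1 , after) wp′ =
    isLastNonzero-unique
      (monicAt⇒isLastNonzero (trans (sym (v≗w _)) vp≡1 , λ j p<j → trans (sym (v≗w j)) (after j p<j)))
      (monicAt⇒isLastNonzero wp′)

  monic-nonzero : ∀ {m} {v : Fin m → K} → Monic v → ¬ IsZero v
  monic-nonzero (p , vp≡1 , _) v≡0 = 0≢1 (trans (sym (v≡0 p)) vp≡1)

  monic-normalise : ∀ {m} (v : Fin m → K) → ¬ IsZero v → ∃₂ λ x y → y ⊗ x ≡ 1# × Monic (λ i → v i ⊗ y)
  monic-normalise v v≢0 =
    let p , vp≢0 , after = lastNonzero v v≢0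
        y , vp⊗y≡1 = inverse (v p) vp≢0
    in v p , y , trans (*-comm y (v p)) vp⊗y≡1 , p , vp⊗y≡1 , λ j p<j → x≡0⇒x⊗y≡0 y (after j p<j)

  monic-scale-unique : ∀ {m} {v w : Fin m → K} {x} → x ≢ 0# → (∀ i → w i ≡ v i ⊗ x) →
                       Monic v → Monic w → x ≡ 1#
  monic-scale-unique {v = v} {w} {x} x≢0 w≡vx (p , vp≡1 , after) (p′ , wp′≡1 , after′) = begin
    x        ≡⟨ *-identityˡ x ⟨
    1# ⊗ x   ≡⟨ cong (_⊗ x) vp≡1 ⟨
    v p ⊗ x  ≡⟨ w≡vx p ⟨
    w p      ≡⟨ cong w p≡p′ ⟩
    w p′     ≡⟨ wp′≡1 ⟩
    1#       ∎
    where
    open ≡-Reasoning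
    p≡p′ = isLastNonzero-unique (isLastNonzero-scale (λ _ → x≢0) w≡vx (monicAt⇒isLastNonzero (vp≡1 , after)))
                                (monicAt⇒isLastNonzero (wp′≡1 , after′))

  insertAt-isZero : ∀ {m} {w : Fin m → K} p → IsZero w → IsZero (insertAt w p 0#)
  insertAt-isZero         zero    w≡0 zero    = refl
  insertAt-isZero         zero    w≡0 (suc r) = w≡0 r
  insertAt-isZero {suc m} (suc p) w≡0 zero    = w≡0 zero
  insertAt-isZero {suc m} (suc p) w≡0 (suc r) = insertAt-isZero p (w≡0 ∘ suc) r

  monic-insertAt-zero : ∀ {m} {w : Fin m → K} p → Monic w → Monic (insertAt w p 0#)
  monic-insertAt-zero         zero    (r , wr≡1 , after) = suc r , wr≡1 , vanishesAfter-suc after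
  monic-insertAt-zero {suc m} (suc p) (zero , w0≡1 , after) =
    zero , w0≡1 , vanishesAfter-zero⁻¹ (insertAt-isZero p (vanishesAfter-zero after))
  monic-insertAt-zero {suc m} (suc p) (suc r , wr≡1 , after) =
    let r′ , monicAt-r′ = monic-insertAt-zero p (r , wr≡1 , vanishesAfter-suc⁻¹ after)
    in suc r′ , proj₁ monicAt-r′ , vanishesAfter-suc (proj₂ monicAt-r′)

  monic-removeAt-zero : ∀ {m} {v : Fin (suc m) → K} p → Monic v → v p ≡ 0# → Monic (removeAt v p)
  monic-removeAt-zero zero (zero , v0≡1 , _) v0≡0 = ⊥-elim (0≢1 (trans (sym v0≡0) v0≡1))
  monic-removeAt-zero zero (suc r , vr≡1 , after) _ = r , vr≡1 , vanishesAfter-suc⁻¹ after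
  monic-removeAt-zero {suc m} (suc p) (zero , v0≡1 , after) _ =
    zero , v0≡1 , vanishesAfter-zero⁻¹ (vanishesAfter-zero after ∘ Fin.punchIn p)
  monic-removeAt-zero {suc m} (suc p) (suc r , vr≡1 , after) vp≡0 =
    let r′ , monicAt-r′ = monic-removeAt-zero p (r , vr≡1 , vanishesAfter-suc⁻¹ after) vp≡0
    in suc r′ , proj₁ monicAt-r′ , vanishesAfter-suc (proj₂ monicAt-r′)

  infixl 7 _∙_
  _∙_ : ∀ {r s c} → Mat F r s → Mat F s c → Mat F r c
  _∙_ = _·_ F

  infix 4 _≋_
  _≋_ : ∀ {k n} → Mat F k n → Mat F k n → Set
  A ≋ B = ∀ i → A i ≗ B i

  infixr 5 _∷ᶜ_
  _∷ᶜ_ : ∀ {k n} → (Fin k → K) → Mat F k n → Mat F k (suc n)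
  (c ∷ᶜ m) i = c i ∷ m i

  ≋-sym : ∀ {k n} {A B : Mat F k n} → A ≋ B → B ≋ A
  ≋-sym A≋B i j = sym (A≋B i j)

  ≋-trans : ∀ {k n} {A B C : Mat F k n} → A ≋ B → B ≋ C → A ≋ C
  ≋-trans A≋B B≋C i j = trans (A≋B i j) (B≋C i j)

  ∷ᶜ-η : ∀ {k n} (M : Mat F k (suc n)) → M ≋ (λ i → M i zero) ∷ᶜ (λ i j → M i (suc j))
  ∷ᶜ-η M i zero    = refl
  ∷ᶜ-η M i (suc j) = refl

  lowerRight : ∀ {k n} → Mat F (suc k) (suc n) → Mat F k n
  lowerRight u i l = u (suc i) (suc l)

  ∙-congʳ : ∀ {r s c} (M : Mat F r s) {A A′ : Mat F s c} → A ≋ A′ → M ∙ A ≋ M ∙ A′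
  ∙-congʳ M A≋A′ i j = ∑-cong (λ l → cong (M i l ⊗_) (A≋A′ l j))

  ∙-congˡ : ∀ {r s c} {M M′ : Mat F r s} (A : Mat F s c) → M ≋ M′ → M ∙ A ≋ M′ ∙ A
  ∙-congˡ A M≋M′ i j = ∑-cong (λ l → cong (_⊗ A l j) (M≋M′ i l))

  ∙-zeroColumn : ∀ {r s c} (M : Mat F r s) (A : Mat F s c) {j} →
                 IsZero (λ l → A l j) → IsZero (λ i → (M ∙ A) i j)
  ∙-zeroColumn M A A≡0 i = ∑-zero _ (λ l → y≡0⇒x⊗y≡0 (M i l) (A≡0 l))

  ∙-scaleColumns : ∀ {r s c} (M : Mat F r s) (A : Mat F s c) (x : Fin c → K) →
                   M ∙ (λ l j → A l j ⊗ x j) ≋ (λ i j → (M ∙ A) i j ⊗ x j)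
  ∙-scaleColumns M A x i j =
    trans (∑-cong (λ l → sym (*-assoc (M i l) (A l j) (x j)))) (∑-distribʳ (λ l → M i l ⊗ A l j) (x j))

  InU-head : ∀ {k n} {u : Mat F (suc k) (suc k)} (A : Mat F (suc k) n) → InU F u → (u ∙ A) zero ≗ A zero
  InU-head {u = u} A (upper≡0 , diag≡1) j = begin
    (u ∙ A) zero j         ≡⟨ ∑-head (λ l → u zero l ⊗ A l j)
                                     (λ l → x≡0⇒x⊗y≡0 (A (suc l) j) (upper≡0 zero (suc l) z<s)) ⟩
    u zero zero ⊗ A zero j ≡⟨ cong (_⊗ A zero j) (diag≡1 zero) ⟩
    1# ⊗ A zero j          ≡⟨ *-identityˡ _ ⟩
    A zero j               ∎
    where open ≡-Reasoning

  InU-lowerRight : ∀ {k} {u : Mat F (suc k) (suc k)} → InU F u → InU F (lowerRight u)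
  InU-lowerRight (upper≡0 , diag≡1) = (λ i j i<j → upper≡0 (suc i) (suc j) (s<s i<j)) , diag≡1 ∘ suc

  InU-extend : ∀ {k} {u : Mat F k k} (w : Fin k → K) → InU F u → InU F ((1# ∷ λ _ → 0#) ∷ (w ∷ᶜ u))
  InU-extend {u = u} w (upper≡0 , diag≡1) = upper≡0′ , λ { zero → refl ; (suc i) → diag≡1 i }
    where
    upper≡0′ : ∀ i j → Fin.toℕ i ℕ.< Fin.toℕ j → ((1# ∷ λ _ → 0#) ∷ (w ∷ᶜ u)) i j ≡ 0#
    upper≡0′ zero    (suc j) _         = refl
    upper≡0′ (suc i) (suc j) (s<s i<j) = upper≡0 i j i<j

  InU-zeroColumn : ∀ {k n} {u : Mat F k k} (A : Mat F k n) {j} → InU F u →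
                   IsZero (λ i → (u ∙ A) i j) → IsZero (λ i → A i j)
  InU-zeroColumn {suc k} A {j} u-unitri uA≡0 zero = trans (sym (InU-head A u-unitri j)) (uA≡0 zero)
  InU-zeroColumn {suc k} {u = u} A {j} u-unitri uA≡0 (suc i) =
    InU-zeroColumn (tail A) (InU-lowerRight u-unitri) (λ l → trans (sym (head-term-vanishes l)) (uA≡0 (suc l))) i
    where
    A0j≡0 = trans (sym (InU-head A u-unitri j)) (uA≡0 zero)
    head-term-vanishes : ∀ l → (u ∙ A) (suc l) j ≡ (lowerRight u ∙ tail A) l j
    head-term-vanishes l =
      trans (cong (_⊕ (lowerRight u ∙ tail A) l j) (y≡0⇒x⊗y≡0 (u (suc l) zero) A0j≡0)) (+-identityˡ _)

  InT-scalesColumns : ∀ {k n} {t : Mat F n n} → InT F t → (X : Mat F k n) → X ∙ t ≋ (λ i j → X i j ⊗ t j j)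
  InT-scalesColumns {t = t} (offDiag≡0 , _) X i j =
    ∑-single (λ l → X i l ⊗ t l j) j (λ l l≢j → y≡0⇒x⊗y≡0 (X i l) (offDiag≡0 l j l≢j))

  diag : ∀ {n} → (Fin n → K) → Mat F n n
  diag x i j with i ≟ j
  ... | yes _ = x j
  ... | no  _ = 0#

  diag-diagonal : ∀ {n} (x : Fin n → K) j → diag x j j ≡ x j
  diag-diagonal x j with j ≟ j
  ... | yes _   = refl
  ... | no  j≢j = ⊥-elim (j≢j refl)

  InT-diag : ∀ {n} {x : Fin n → K} → (∀ j → x j ≢ 0#) → InT F (diag x)
  InT-diag {x = x} x≢0 = offDiag≡0 , λ j djj≡0 → x≢0 j (trans (sym (diag-diagonal x j)) djj≡0)
    where
    offDiag≡0 : ∀ i j → i ≢ j → diag x i j ≡ 0#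
    offDiag≡0 i j i≢j with i ≟ j
    ... | yes i≡j = ⊥-elim (i≢j i≡j)
    ... | no  _   = refl

  -- Canonical forms

  Echelon : ∀ {k n} → Mat F k n → Set
  Echelon {zero}  m = ⊤
  Echelon {suc k} m = ∃ λ p → IsLastNonzero (m zero) p × IsZero (λ l → m (suc l) p) × Echelon (tail m)

  Canonical : ∀ {k n} → Mat F k n → Set
  Canonical m = Echelon m × (∀ j → Monic (λ i → m i j))

  Echelon-resp : ∀ {k n} {A B : Mat F k n} → A ≋ B → Echelon A → Echelon B
  Echelon-resp {zero}  A≋B _ = _
  Echelon-resp {suc k} A≋B (p , (A0p≢0 , after) , below , ech) =
    p , ((λ B0p≡0 → A0p≢0 (trans (A≋B zero p) B0p≡0)) , λ j p<j → trans (sym (A≋B zero j)) (after j p<j)) ,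
    (λ l → trans (sym (A≋B (suc l) p)) (below l)) , Echelon-resp (A≋B ∘ suc) ech

  echelon⇒fullRank : ∀ {k n} {m : Mat F k n} → Echelon m → FullRank F m
  echelon⇒fullRank {zero} _ c _ ()
  echelon⇒fullRank {suc k} {m = m} (p , (m0p≢0 , _) , below , ech) c ∑≡0 = λ
    { zero    → c0≡0
    ; (suc i) → echelon⇒fullRank {m = tail m} ech (tail c) (λ j → trans (sym (head-term-vanishes j)) (∑≡0 j)) i
    }
    where
    c0≡0 : c zero ≡ 0#
    c0≡0 = y≢0⇒x⊗y≡0⇒x≡0 m0p≢0
             (trans (sym (∑-head (λ i → c i ⊗ m i p) (λ l → y≡0⇒x⊗y≡0 (c (suc l)) (below l)))) (∑≡0 p))
    head-term-vanishes : ∀ j → ∑ (λ i → c i ⊗ m i j) ≡ ∑ (λ l → c (suc l) ⊗ m (suc l) j)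
    head-term-vanishes j =
      trans (cong (_⊕ ∑ (λ l → c (suc l) ⊗ m (suc l) j)) (x≡0⇒x⊗y≡0 (m zero j) c0≡0)) (+-identityˡ _)

  echelon-row-nonzero : ∀ {k n} {m : Mat F k n} → Echelon m → ∀ i → ¬ IsZero (m i)
  echelon-row-nonzero (p , (m0p≢0 , _) , _) zero    m0≡0 = m0p≢0 (m0≡0 p)
  echelon-row-nonzero (_ , _ , _ , ech)     (suc i)      = echelon-row-nonzero ech i

  echelon-scaleColumns : ∀ {k n} {m : Mat F k n} {s : Fin n → K} → (∀ j → s j ≢ 0#) →
                         Echelon m → Echelon (λ i j → m i j ⊗ s j)
  echelon-scaleColumns {zero}  s≢0 _ = _
  echelon-scaleColumns {suc k} {s = s} s≢0 (p , last , below , ech) =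
    p , isLastNonzero-scale s≢0 (λ _ → refl) last , (λ l → x≡0⇒x⊗y≡0 (s p) (below l)) ,
    echelon-scaleColumns s≢0 ech

  canonical⇒InM : ∀ {k n} {m : Mat F k n} → Canonical m → InM F n k m
  canonical⇒InM (ech , monic) = echelon⇒fullRank ech , λ j → monic-nonzero (monic j)

  -- Uniqueness of canonical forms

  echelon-rigid : ∀ {k n} {A B : Mat F k n} {u : Mat F k k} {s : Fin n → K} →
                  Echelon A → Echelon B → InU F u → (∀ j → s j ≢ 0#) →
                  (∀ i j → B i j ≡ (u ∙ A) i j ⊗ s j) → ∀ i j → B i j ≡ A i j ⊗ s j
  echelon-rigid {zero} _ _ _ _ _ ()
  echelon-rigid {suc k} {A = A} {B} {u} {s}
                (pA , lastA , belowA , echA) (pB , lastB , belowB , echB) u-unitri s≢0 B≡uAs = rigid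
    where
    head≡ : ∀ j → B zero j ≡ A zero j ⊗ s j
    head≡ j = trans (B≡uAs zero j) (cong (_⊗ s j) (InU-head A u-unitri j))

    pA≡pB : pA ≡ pB
    pA≡pB = isLastNonzero-unique (isLastNonzero-scale s≢0 head≡ lastA) lastB

    uA-below : ∀ i → (u ∙ A) (suc i) pA ≡ 0#
    uA-below i = y≢0⇒x⊗y≡0⇒x≡0 (s≢0 pA)
                   (trans (sym (B≡uAs (suc i) pA)) (subst (λ p → B (suc i) p ≡ 0#) (sym pA≡pB) (belowB i)))

    u-col0≡0 : ∀ i → u (suc i) zero ≡ 0#
    u-col0≡0 i = y≢0⇒x⊗y≡0⇒x≡0 (proj₁ lastA) (begin
      u (suc i) zero ⊗ A zero pA                         ≡⟨ +-identityʳ _ ⟨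
      u (suc i) zero ⊗ A zero pA ⊕ 0#                    ≡⟨ cong (u (suc i) zero ⊗ A zero pA ⊕_)
                                                              (∙-zeroColumn (lowerRight u) (tail A) belowA i) ⟨
      (u ∙ A) (suc i) pA                                 ≡⟨ uA-below i ⟩
      0#                                                 ∎)
      where open ≡-Reasoning

    tail≡ : ∀ i j → B (suc i) j ≡ (lowerRight u ∙ tail A) i j ⊗ s j
    tail≡ i j = trans (B≡uAs (suc i) j)
                  (cong (_⊗ s j) (trans (cong (_⊕ (lowerRight u ∙ tail A) i j)
                                             (x≡0⇒x⊗y≡0 (A zero j) (u-col0≡0 i))) (+-identityˡ _)))

    rigid : ∀ i j → B i j ≡ A i j ⊗ s j
    rigid zero    = head≡
    rigid (suc i) = echelon-rigid echA echB (InU-lowerRight u-unitri) s≢0 tail≡ i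

  canonical-unique : ∀ {k n} {A B : Mat F k n} → Canonical A → Canonical B → SameDoubleCoset F n k A B → A ≋ B
  canonical-unique {A = A} {B} (echA , monicA) (echB , monicB) (u , t , u-unitri , t-diag@(_ , t≢0) , B≡uAt) i j =
    sym (begin
      B i j         ≡⟨ B≡At i j ⟩
      A i j ⊗ t j j ≡⟨ cong (A i j ⊗_) (t≡1 j) ⟩
      A i j ⊗ 1#    ≡⟨ *-identityʳ _ ⟩
      A i j         ∎)
    where
    open ≡-Reasoning
    B≡At : ∀ i j → B i j ≡ A i j ⊗ t j j
    B≡At = echelon-rigid echA echB u-unitri t≢0 (λ i j → trans (B≡uAt i j) (InT-scalesColumns t-diag (u ∙ A) i j))
    t≡1 : ∀ j → t j j ≡ 1#
    t≡1 j = monic-scale-unique (t≢0 j) (λ i → B≡At i j) (monicA j) (monicB j)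

  sameDoubleCoset-respˡ : ∀ {k n} {a a′ b : Mat F k n} → a ≋ a′ →
                          SameDoubleCoset F n k a′ b → SameDoubleCoset F n k a b
  sameDoubleCoset-respˡ a≋a′ (u , t , u-unitri , t-diag , b≡ua′t) =
    u , t , u-unitri , t-diag ,
    λ i j → trans (b≡ua′t i j) (∙-congˡ t (∙-congʳ u (≋-sym a≋a′)) i j)

  -- Existence of canonical forms

  fullRank⇒head-nonzero : ∀ {k n} (a : Mat F (suc k) n) → FullRank F a → ¬ IsZero (a zero)
  fullRank⇒head-nonzero a fr a0≡0 = 0≢1 (sym (fr (1# ∷ λ _ → 0#) ∑≡0 zero))
    where
    ∑≡0 : ∀ j → ∑ (λ i → (1# ∷ λ _ → 0#) i ⊗ a i j) ≡ 0#
    ∑≡0 j = trans (∑-head (λ i → (1# ∷ λ _ → 0#) i ⊗ a i j) (λ l → zeroˡ (a (suc l) j)))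
                  (trans (*-identityˡ (a zero j)) (a0≡0 j))

  addHeadMultiples : ∀ {k n} → (Fin k → K) → Mat F (suc k) n → Mat F k n
  addHeadMultiples v a l j = v l ⊗ a zero j ⊕ a (suc l) j

  fullRank-addHeadMultiples : ∀ {k n} (v : Fin k → K) (a : Mat F (suc k) n) →
                              FullRank F a → FullRank F (addHeadMultiples v a)
  fullRank-addHeadMultiples v a fr c ∑≡0 l = fr (∑ (λ l → c l ⊗ v l) ∷ c) ∑′≡0 (suc l)
    where
    ∑′≡0 : ∀ j → ∑ (λ i → (∑ (λ l → c l ⊗ v l) ∷ c) i ⊗ a i j) ≡ 0#
    ∑′≡0 j = begin
      ∑ (λ l → c l ⊗ v l) ⊗ a zero j ⊕ ∑ (λ l → c l ⊗ a (suc l) j)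
        ≡⟨ cong (_⊕ ∑ (λ l → c l ⊗ a (suc l) j)) (∑-distribʳ (λ l → c l ⊗ v l) (a zero j)) ⟨
      ∑ (λ l → c l ⊗ v l ⊗ a zero j) ⊕ ∑ (λ l → c l ⊗ a (suc l) j)
        ≡⟨ ∑-distrib-⊕ (λ l → c l ⊗ v l ⊗ a zero j) (λ l → c l ⊗ a (suc l) j) ⟨
      ∑ (λ l → c l ⊗ v l ⊗ a zero j ⊕ c l ⊗ a (suc l) j)
        ≡⟨ ∑-cong (λ l → trans (cong (_⊕ c l ⊗ a (suc l) j) (*-assoc (c l) (v l) (a zero j)))
                               (sym (distribˡ (c l) (v l ⊗ a zero j) (a (suc l) j)))) ⟩
      ∑ (λ l → c l ⊗ addHeadMultiples v a l j)
        ≡⟨ ∑≡0 j ⟩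
      0# ∎
      where open ≡-Reasoning

  record EchelonFactorisation {k n} (a : Mat F k n) : Set where
    field
      u               : Mat F k k
      r               : Mat F k n
      u-unitriangular : InU F u
      r-echelon       : Echelon r
      a≋u∙r           : a ≋ u ∙ r

  -- The head row's last nonzero entry a zero p clears column p in the rows below;
  -- u undoes these row operations.
  echelonFactorisation : ∀ {k n} (a : Mat F k n) → FullRank F a → EchelonFactorisation a
  echelonFactorisation {zero} a _ = record
    { u = λ () ; r = λ () ; u-unitriangular = (λ ()) , (λ ()) ; r-echelon = tt ; a≋u∙r = λ () }
  echelonFactorisation {suc k} a fr with lastNonzero (a zero) (fullRank⇒head-nonzero a fr)
  ... | p , last@(a0p≢0 , _) = record
    { u               = (1# ∷ λ _ → 0#) ∷ ((⊖_ ∘ v) ∷ᶜ IH.u)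
    ; r               = a zero ∷ IH.r
    ; u-unitriangular = InU-extend (⊖_ ∘ v) IH.u-unitriangular
    ; r-echelon       = p , last ,
                        InU-zeroColumn IH.r IH.u-unitriangular (λ l → trans (sym (IH.a≋u∙r l p)) (cleared l)) ,
                        IH.r-echelon
    ; a≋u∙r           = λ { zero j → sym (InU-head (a zero ∷ IH.r) (InU-extend (⊖_ ∘ v) IH.u-unitriangular) j)
                          ; (suc i) j → sym (trans (cong ((⊖ v i) ⊗ a zero j ⊕_) (sym (IH.a≋u∙r i j)))
                                                   (⊖x⊗z⊕[x⊗z⊕w]≡w (v i) (a zero j) (a (suc i) j))) }
    }
    where
    y = proj₁ (inverse (a zero p) a0p≢0)
    a0p⊗y≡1 = proj₂ (inverse (a zero p) a0p≢0)

    v : Fin k → K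
    v l = ⊖ (a (suc l) p ⊗ y)

    module IH = EchelonFactorisation (echelonFactorisation (addHeadMultiples v a) (fullRank-addHeadMultiples v a fr))

    cleared : ∀ l → addHeadMultiples v a l p ≡ 0#
    cleared l = begin
      ⊖ (b ⊗ y) ⊗ h ⊕ b    ≡⟨ cong (_⊕ b) (-‿distribˡ-* (b ⊗ y) h) ⟨
      ⊖ (b ⊗ y ⊗ h) ⊕ b    ≡⟨ cong (λ z → ⊖ z ⊕ b) (*-assoc b y h) ⟩
      ⊖ (b ⊗ (y ⊗ h)) ⊕ b  ≡⟨ cong (λ z → ⊖ (b ⊗ z) ⊕ b) (trans (*-comm y h) a0p⊗y≡1) ⟩
      ⊖ (b ⊗ 1#) ⊕ b       ≡⟨ cong (λ z → ⊖ z ⊕ b) (*-identityʳ b) ⟩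
      ⊖ b ⊕ b              ≡⟨ -‿inverseˡ b ⟩
      0#                   ∎
      where
      open ≡-Reasoning
      b = a (suc l) p
      h = a zero p

  canonical-exists : ∀ {k n} (a : Mat F k n) → InM F n k a → ∃ λ c → Canonical c × SameDoubleCoset F n k c a
  canonical-exists {k} {n} a (fr , noZeroColumn) =
    c , (echelon-scaleColumns y≢0 EF.r-echelon , c-monic) ,
    EF.u , diag x , EF.u-unitriangular , InT-diag x≢0 , a≡uct
    where
    module EF = EchelonFactorisation (echelonFactorisation a fr)

    r-column-nonzero : ∀ j → ¬ IsZero (λ i → EF.r i j)
    r-column-nonzero j r≡0 = noZeroColumn j (λ i → trans (EF.a≋u∙r i j) (∙-zeroColumn EF.u EF.r r≡0 i))

    normalised = λ j → monic-normalise (λ i → EF.r i j) (r-column-nonzero j)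

    x y : Fin n → K
    x = proj₁ ∘ normalised
    y = proj₁ ∘ proj₂ ∘ normalised

    y⊗x≡1 : ∀ j → y j ⊗ x j ≡ 1#
    y⊗x≡1 = proj₁ ∘ proj₂ ∘ proj₂ ∘ normalised

    x≢0 : ∀ j → x j ≢ 0#
    x≢0 j = x⊗y≡1⇒y≢0 (y⊗x≡1 j)

    y≢0 : ∀ j → y j ≢ 0#
    y≢0 j = x⊗y≡1⇒y≢0 (trans (*-comm (x j) (y j)) (y⊗x≡1 j))

    c : Mat F k n
    c i j = EF.r i j ⊗ y j

    c-monic : ∀ j → Monic (λ i → c i j)
    c-monic = proj₂ ∘ proj₂ ∘ proj₂ ∘ normalised

    r≡cx : EF.r ≋ (λ i j → c i j ⊗ x j)
    r≡cx i j = sym (trans (*-assoc (EF.r i j) (y j) (x j)) (trans (cong (EF.r i j ⊗_) (y⊗x≡1 j)) (*-identityʳ _)))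

    a≡uct : ∀ i j → a i j ≡ ((EF.u ∙ c) ∙ diag x) i j
    a≡uct i j = begin
      a i j                              ≡⟨ EF.a≋u∙r i j ⟩
      (EF.u ∙ EF.r) i j                  ≡⟨ ∙-congʳ EF.u r≡cx i j ⟩
      (EF.u ∙ (λ i j → c i j ⊗ x j)) i j ≡⟨ ∙-scaleColumns EF.u c x i j ⟩
      (EF.u ∙ c) i j ⊗ x j               ≡⟨ cong ((EF.u ∙ c) i j ⊗_) (diag-diagonal x j) ⟨
      (EF.u ∙ c) i j ⊗ diag x j j        ≡⟨ InT-scalesColumns (InT-diag x≢0) (EF.u ∙ c) i j ⟨
      ((EF.u ∙ c) ∙ diag x) i j          ∎
      where open ≡-Reasoning

  -- Counting canonical forms by their first column

  insertZeroRow : ∀ {k n} → Fin (suc k) → Mat F k n → Mat F (suc k) n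
  insertZeroRow p m i j = insertAt (λ l → m l j) p 0# i

  echelon-∷ᶜ : ∀ {k n} (c : Fin k → K) {m : Mat F k n} → Echelon m → Echelon (c ∷ᶜ m)
  echelon-∷ᶜ {zero}  c _ = tt
  echelon-∷ᶜ {suc k} c (p , (m0p≢0 , after) , below , ech) =
    suc p , (m0p≢0 , vanishesAfter-suc after) , below , echelon-∷ᶜ (tail c) ech

  echelon-∷ᶜ⁻¹ : ∀ {k n} {c : Fin k → K} {m : Mat F k n} →
                 (∀ i → IsZero (m i) → c i ≡ 0#) → Echelon (c ∷ᶜ m) → Echelon m
  echelon-∷ᶜ⁻¹ {zero}  _ _ = tt
  echelon-∷ᶜ⁻¹ {suc k} zeroRow⇒c≡0 (zero , (c0≢0 , after) , _) =
    ⊥-elim (c0≢0 (zeroRow⇒c≡0 zero (vanishesAfter-zero after)))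
  echelon-∷ᶜ⁻¹ {suc k} zeroRow⇒c≡0 (suc p , (m0p≢0 , after) , below , ech) =
    p , (m0p≢0 , vanishesAfter-suc⁻¹ after) , below , echelon-∷ᶜ⁻¹ (zeroRow⇒c≡0 ∘ suc) ech

  echelon-insertPivotRow : ∀ {k n} {c : Fin (suc k) → K} {m : Mat F k n} p →
                           MonicAt c p → Echelon m → Echelon (c ∷ᶜ insertZeroRow p m)
  echelon-insertPivotRow {c = c} zero (c0≡1 , after) ech =
    zero , (monicAt⇒isLastNonzero (c0≡1 , vanishesAfter-zero⁻¹ λ _ → refl)) ,
    vanishesAfter-zero after , echelon-∷ᶜ (tail c) ech
  echelon-insertPivotRow {suc k} (suc p) (cp≡1 , after) (pm , (m0pm≢0 , afterm) , below , ech) =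
    suc pm , (m0pm≢0 , vanishesAfter-suc afterm) , insertAt-isZero p below ,
    echelon-insertPivotRow p (cp≡1 , vanishesAfter-suc⁻¹ after) ech

  echelon-removePivotRow : ∀ {k n} {c : Fin (suc k) → K} {m : Mat F k n} p →
                           MonicAt c p → Echelon (c ∷ᶜ insertZeroRow p m) → Echelon m
  echelon-removePivotRow zero (_ , after) (_ , _ , _ , ech) = echelon-∷ᶜ⁻¹ (λ i _ → vanishesAfter-zero after i) ech
  echelon-removePivotRow {suc k} (suc p) (cp≡1 , _) (zero , _ , below , _) = ⊥-elim (0≢1 (trans (sym (below p)) cp≡1))
  echelon-removePivotRow {suc k} {m = m} (suc p) (cp≡1 , after) (suc pm , (m0pm≢0 , afterM) , below , ech) =
    pm , (m0pm≢0 , vanishesAfter-suc⁻¹ afterM) ,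
    (λ l → trans (sym (insertAt-punchIn (λ l → m (suc l) pm) p 0# l)) (below (Fin.punchIn p l))) ,
    echelon-removePivotRow p (cp≡1 , vanishesAfter-suc⁻¹ after) ech

  echelon-pivotColumn : ∀ {k n} {M : Mat F k (suc n)} → Echelon M → ∀ i →
                        IsZero (tail (M i)) → IsLastNonzero (λ l → M l zero) i
  echelon-pivotColumn (zero , (M00≢0 , _) , below , _) zero _ = M00≢0 , vanishesAfter-zero⁻¹ below
  echelon-pivotColumn (suc p , (M0p≢0 , _) , _ , _) zero M0≡0 = ⊥-elim (M0p≢0 (M0≡0 p))
  echelon-pivotColumn (_ , _ , _ , ech) (suc i) Mi≡0 =
    let Mi0≢0 , after = echelon-pivotColumn ech i Mi≡0 in Mi0≢0 , vanishesAfter-suc after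

  PointedVector : ℕ → Set
  PointedVector m = (Fin m → K) × Fin m

  infix 4 _≈ᵖ_
  _≈ᵖ_ : ∀ {m} → PointedVector m → PointedVector m → Set
  (v , p) ≈ᵖ (w , p′) = v ≗ w × p ≡ p′

  IsMonicAt : ∀ {m} → PointedVector m → Set
  IsMonicAt (v , p) = MonicAt v p

  field-count : HasClassCount (λ (_ : K) → ⊤) _≡_ q
  field-count = record { rep = λ x → x ; rep-in = _ ; distinct = λ _ _ x≡y → x≡y ; cover = λ x _ → x , refl }

  monicAt-count : ∀ m → HasClassCount (IsMonicAt {m}) _≈ᵖ_ ([ m ]q q)
  monicAt-count zero    = classCount-empty λ { (_ , ()) }
  monicAt-count (suc m) = classCount-⊎ ≈ᵖ-sym split proj₁ proj₁ disjoint head-count tail-count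
    where
    ≈ᵖ-sym : Symmetric (_≈ᵖ_ {suc m})
    ≈ᵖ-sym (v≗w , p≡p′) = sym ∘ v≗w , sym p≡p′

    split : ∀ {a} → IsMonicAt a → IsMonicAt a × proj₂ a ≡ zero ⊎ IsMonicAt a × proj₂ a ≢ zero
    split {_ , zero}  monic = inj₁ (monic , refl)
    split {_ , suc p} monic = inj₂ (monic , λ ())

    disjoint : ∀ {a b} → IsMonicAt a × proj₂ a ≡ zero → IsMonicAt b × proj₂ b ≢ zero → ¬ a ≈ᵖ b
    disjoint (_ , pa≡0) (_ , pb≢0) (_ , pa≡pb) = pb≢0 (trans (sym pa≡pb) pa≡0)

    head-count : HasClassCount (λ a → IsMonicAt a × proj₂ a ≡ zero) _≈ᵖ_ 1
    head-count = classCount-single (1# ∷ (λ _ → 0#) , zero) ((refl , vanishesAfter-zero⁻¹ λ _ → refl) , refl)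
      λ { (v , zero) ((v0≡1 , after) , _) →
            (λ { zero → sym v0≡1 ; (suc j) → sym (vanishesAfter-zero after j) }) , refl }

    tail-count : HasClassCount (λ a → IsMonicAt a × proj₂ a ≢ zero) _≈ᵖ_ (q * [ m ]q q)
    tail-count = classCount-× (λ x (w , p) → x ∷ w , suc p)
      (λ (v≗w , p≡p′) (w≗u , p′≡p″) → (λ i → trans (v≗w i) (w≗u i)) , trans p≡p′ p′≡p″)
      (λ { x≡x′ (w≗w′ , p≡p′) → (λ { zero → x≡x′ ; (suc i) → w≗w′ i }) , cong suc p≡p′ })
      (λ { _ (wp≡1 , after) → (wp≡1 , vanishesAfter-suc after) , λ () })
      (λ { _ _ _ _ (v≗v′ , p≡p′) → v≗v′ zero , v≗v′ ∘ suc , suc-injective p≡p′ })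
      (λ { (v , zero) (_ , 0≢0) → ⊥-elim (0≢0 refl)
         ; (v , suc p) ((vp≡1 , after) , _) →
             v zero , (tail v , p) , tt , (vp≡1 , vanishesAfter-suc⁻¹ after) ,
             (λ { zero → refl ; (suc i) → refl }) , refl })
      field-count (monicAt-count m)

  HasPivotInColumn0 : ∀ {k n} → Mat F k (suc n) → Set
  HasPivotInColumn0 M = ∃ λ i → IsZero (tail (M i))

  prependPivotColumn : ∀ {k n} → PointedVector (suc k) → Mat F k n → Mat F (suc k) (suc n)
  prependPivotColumn (c , p) m = c ∷ᶜ insertZeroRow p m

  removeAt-insertZeroRow : ∀ {k n} p {m m′ : Mat F k n} → insertZeroRow p m ≋ insertZeroRow p m′ → m ≋ m′
  removeAt-insertZeroRow p {m} {m′} e l j = begin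
    m l j                                  ≡⟨ insertAt-punchIn (λ l → m l j) p 0# l ⟨
    insertZeroRow p m (Fin.punchIn p l) j  ≡⟨ e (Fin.punchIn p l) j ⟩
    insertZeroRow p m′ (Fin.punchIn p l) j ≡⟨ insertAt-punchIn (λ l → m′ l j) p 0# l ⟩
    m′ l j                                 ∎
    where open ≡-Reasoning

  pivotColumn-count : ∀ {n k} → HasClassCount (Canonical {k} {n}) _≋_ ([ k ]!q q * Stirq q n k) →
                      HasClassCount (λ M → Canonical M × HasPivotInColumn0 M) _≋_
                                    ([ suc k ]q q * ([ k ]!q q * Stirq q n k))
  pivotColumn-count {n} {k} =
    classCount-× prependPivotColumn ≋-trans g-cong g-in g-injective g-cover (monicAt-count (suc k))
    where
    g-cong : ∀ {x x′} {m m′ : Mat F k n} → x ≈ᵖ x′ → m ≋ m′ → prependPivotColumn x m ≋ prependPivotColumn x′ m′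
    g-cong         (c≗c′ , refl) m≋m′ i zero    = c≗c′ i
    g-cong {_ , p} (c≗c′ , refl) m≋m′ i (suc j) = insertAt-cong p 0# (λ l → m≋m′ l j) i

    g-in : ∀ {x} {m : Mat F k n} → IsMonicAt x → Canonical m →
           Canonical (prependPivotColumn x m) × HasPivotInColumn0 (prependPivotColumn x m)
    g-in {_ , p} {m} cp (ech , monic) =
      (echelon-insertPivotRow p cp ech , λ { zero → p , cp ; (suc j) → monic-insertAt-zero p (monic j) }) ,
      p , λ j → insertAt-lookup (λ l → m l j) p 0#

    g-injective : ∀ {x m x′ m′} → IsMonicAt x → Canonical m → IsMonicAt x′ → Canonical m′ →
                  prependPivotColumn x m ≋ prependPivotColumn x′ m′ → x ≈ᵖ x′ × m ≋ m′
    g-injective {_ , p} cp _ c′p′ _ e with monicAt-unique (λ i → e i zero) cp c′p′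
    ... | refl = ((λ i → e i zero) , refl) , removeAt-insertZeroRow p (λ i j → e i (suc j))

    g-cover : ∀ M → Canonical M × HasPivotInColumn0 M →
              ∃₂ λ x m → IsMonicAt x × Canonical m × prependPivotColumn x m ≋ M
    g-cover M ((ech , monic) , i , Mi≡0) =
      (c , i) , m , ci , (echelon-removePivotRow i ci (Echelon-resp M≋ ech) , monic-m) , ≋-sym M≋
      where
      c = λ l → M l zero
      m = λ l j → M (Fin.punchIn i l) (suc j)

      ci : MonicAt c i
      ci = subst (MonicAt c)
             (isLastNonzero-unique (monicAt⇒isLastNonzero (proj₂ (monic zero)))
                                   (echelon-pivotColumn {M = M} ech i Mi≡0))
             (proj₂ (monic zero))

      M≋ : M ≋ c ∷ᶜ insertZeroRow i m
      M≋ l zero    = refl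
      M≋ l (suc j) = begin
        M l (suc j)                                 ≡⟨ insertAt-removeAt column i l ⟨
        insertAt (removeAt column i) i (column i) l ≡⟨ cong (λ z → insertAt (removeAt column i) i z l) (Mi≡0 j) ⟩
        insertZeroRow i m l j                       ∎
        where
        open ≡-Reasoning
        column = λ l → M l (suc j)

      monic-m : ∀ j → Monic (λ l → m l j)
      monic-m j = monic-removeAt-zero i (monic (suc j)) (Mi≡0 j)

  freeColumn-count : ∀ {n k} → HasClassCount (Canonical {suc k} {n}) _≋_ ([ suc k ]!q q * Stirq q n (suc k)) →
                     HasClassCount (λ M → Canonical M × ¬ HasPivotInColumn0 M) _≋_
                                   ([ suc k ]q q * ([ suc k ]!q q * Stirq q n (suc k)))
  freeColumn-count {n} {k} = classCount-× (λ (c , _) m → c ∷ᶜ m) ≋-trans g-cong g-in g-injective g-cover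
                                         (monicAt-count (suc k))
    where
    g-cong : ∀ {x x′ : PointedVector (suc k)} {m m′ : Mat F (suc k) n} → x ≈ᵖ x′ → m ≋ m′ →
             proj₁ x ∷ᶜ m ≋ proj₁ x′ ∷ᶜ m′
    g-cong (c≗c′ , _) m≋m′ i zero    = c≗c′ i
    g-cong (c≗c′ , _) m≋m′ i (suc j) = m≋m′ i j

    g-in : ∀ {x} {m : Mat F (suc k) n} → IsMonicAt x → Canonical m →
           Canonical (proj₁ x ∷ᶜ m) × ¬ HasPivotInColumn0 (proj₁ x ∷ᶜ m)
    g-in {c , p} {m} cp (ech , monic) =
      (echelon-∷ᶜ c {m} ech , λ { zero → p , cp ; (suc j) → monic j }) ,
      λ (i , mi≡0) → echelon-row-nonzero {m = m} ech i mi≡0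

    g-injective : ∀ {x} {m} {x′} {m′} → IsMonicAt x → Canonical m → IsMonicAt x′ → Canonical m′ →
                  proj₁ x ∷ᶜ m ≋ proj₁ x′ ∷ᶜ m′ → x ≈ᵖ x′ × m ≋ m′
    g-injective cp _ c′p′ _ e =
      ((λ i → e i zero) , monicAt-unique (λ i → e i zero) cp c′p′) , λ i j → e i (suc j)

    g-cover : ∀ M → Canonical M × ¬ HasPivotInColumn0 M →
              ∃₂ λ x m → IsMonicAt x × Canonical m × proj₁ x ∷ᶜ m ≋ M
    g-cover M ((ech , monic) , no-pivot) =
      ((λ i → M i zero) , proj₁ (monic zero)) , (λ i j → M i (suc j)) , proj₂ (monic zero) ,
      (echelon-∷ᶜ⁻¹ {c = λ i → M i zero} {m = λ i j → M i (suc j)} (λ i Mi≡0 → ⊥-elim (no-pivot (i , Mi≡0)))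
                    (Echelon-resp (∷ᶜ-η M) ech) ,
       monic ∘ suc) ,
      ≋-sym (∷ᶜ-η M)

  canonical-count : ∀ n k → HasClassCount (Canonical {k} {n}) _≋_ ([ k ]!q q * Stirq q n k)
  canonical-count zero    zero    = classCount-single (λ ()) (tt , λ ()) (λ _ _ ())
  canonical-count zero    (suc k) =
    subst (HasClassCount Canonical _≋_) (sym (*-zeroʳ ([ suc k ]!q q)))
      (classCount-empty λ { _ ((() , _) , _) })
  canonical-count (suc n) zero    = classCount-empty λ _ (_ , monic) → ¬Fin0 (proj₁ (monic zero))
  canonical-count (suc n) (suc k) =
    subst (HasClassCount Canonical _≋_)
      (sym (count-recurrence ([ k ]!q q) ([ suc k ]q q) (Stirq q n k) (Stirq q n (suc k))))
      (classCount-⊎ ≋-sym split proj₁ proj₁ disjoint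
        (pivotColumn-count (canonical-count n k)) (freeColumn-count (canonical-count n (suc k))))
    where
    count-recurrence : ∀ a b x y → (a * b) * (x + b * y) ≡ b * (a * x) + b * ((a * b) * y)
    count-recurrence = solve 4 (λ a b x y → (a :* b) :* (x :+ b :* y) := b :* (a :* x) :+ b :* ((a :* b) :* y)) refl
      where open +-*-Solver

    split : ∀ {M} → Canonical M → Canonical M × HasPivotInColumn0 M ⊎ Canonical M × ¬ HasPivotInColumn0 M
    split {M} can with any? (λ i → isZero? (tail (M i)))
    ... | yes pivot    = inj₁ (can , pivot)
    ... | no  no-pivot = inj₂ (can , no-pivot)

    disjoint : ∀ {A B} → Canonical A × HasPivotInColumn0 A → Canonical B × ¬ HasPivotInColumn0 B → ¬ A ≋ B
    disjoint (_ , i , Ai≡0) (_ , no-pivot) A≋B = no-pivot (i , λ j → trans (sym (A≋B i (suc j))) (Ai≡0 j))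

corollary3p5 : (q : ℕ) (F : FiniteField q) (n k : ℕ) → 1 ≤ k → k ≤ n →
                 CardY F n k ([ k ]!q q * Stirq q n k)
corollary3p5 q F n k _ _ =
  classCount-transversal (canonical⇒InM F) (canonical-unique F) (canonical-exists F)
                         (sameDoubleCoset-respˡ F) (canonical-count F n k)
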